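{- Let $r \geq 4$ and let $J \subseteq 2^{[r]} \setminus \{[r]\}$ be a family closed under intersection with $\rho(J) = r-1$ such that $J$ is not central. Then $J$ contains at least two singletons $\{i\}$, $i \in [r]$, as members.
   Context: The rank of $J \subseteq 2^{[r]}$ is $\rho(J) = \min\{|e| : e \subseteq [r],\ \text{no member of } J \text{ contains } e\}$. A family $J \subseteq 2^{[r]}$ is central if there exists $x \in [r]$ such that $J$ contains every $(r-1)$-subset of $[r]$ containing $x$ but does not contain $[r] \setminus \{x\}$. -}

module Defs where

open import Data.Nat using (ℕ; _<_; _∸_)
open import Data.Fin using (Fin)
open import Data.Fin.Subset using (Subset; _⊆_; _∩_; ∣_∣; ⁅_⁆; ∁; _∈_; ⊤)
open import Data.Product using (Σ; ∃; _×_)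
open import Relation.Nullary using (¬_)
open import Relation.Binary.PropositionalEquality using (_≡_; _≢_)

Family : ℕ → Set₁
Family r = Subset r → Set

Covered : ∀ {r} → Family r → Subset r → Set
Covered {r} J e = Σ (Subset r) λ A → J A × (e ⊆ A)

HasRank : ∀ {r} → Family r → ℕ → Set
HasRank {r} J k =
  (Σ (Subset r) λ e → (∣ e ∣ ≡ k) × ¬ Covered J e)
  × (∀ (e : Subset r) → ∣ e ∣ < k → Covered J e)

ProperFamily : ∀ {r} → Family r → Set
ProperFamily J = ¬ J ⊤

IntersectionClosed : ∀ {r} → Family r → Set
IntersectionClosed {r} J = ∀ (A B : Subset r) → J A → J B → J (A ∩ B)

Central : ∀ {r} → Family r → Set
Central {r} J = Σ (Fin r) λ x →
  (∀ (S : Subset r) → ∣ S ∣ ≡ r ∸ 1 → x ∈ S → J S) × ¬ J (∁ ⁅ x ⁆)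

-- Write e = [r] ∖ {x} for the uncovered (r−1)-set. Every e ∖ {y}, y ≠ x, lies in some
-- B_y ∈ J, and y ∉ B_y since e is uncovered, so B_y is [r] ∖ {y} or [r] ∖ {x, y}. If every
-- B_y contains x, then J contains every (r−1)-set through x and J is central. Otherwise
-- B_{y₀} = [r] ∖ {x, y₀} for some y₀, and for each of the r − 2 ≥ 2 points i ∉ {x, y₀} the
-- intersection of B_{y₀} with all B_z, z ∉ {x, i}, is {i}.
module Submission where

open import Defs
open import Data.Nat using (ℕ; zero; suc; _≤_; _<_; _<?_; _∸_; s≤s; z≤n)
open import Data.Nat.Properties using (m+n∸n≡m; suc-injective; <-irrefl; ≤-refl; ≤-trans)
open import Data.Bool using (not)
open import Data.Bool.Properties using (not-involutive)
open import Data.Fin using (Fin; zero; suc; _≟_)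
open import Data.Fin.Properties using (¬∀⟶∃¬)
open import Data.Fin.Subset
  using (Subset; _⊆_; _∩_; _─_; _-_; ∣_∣; ⁅_⁆; ∁; _∈_; _∉_; ⊥; inside; outside; Nonempty)
open import Data.Fin.Subset.Properties
open import Data.Vec using (map; _∷_; here; there)
open import Data.Vec.Properties using (map-∘; map-cong; map-id)
open import Data.Product using (Σ; ∃; ∃₂; _×_; _,_; proj₁; proj₂)
open import Data.Sum using (_⊎_; inj₁; inj₂)
open import Function using (_∘_)
open import Relation.Nullary using (¬_; Dec; yes; no; contradiction)
open import Relation.Nullary.Decidable using (recompute)
open import Relation.Binary.PropositionalEquality
  using (_≡_; _≢_; refl; sym; trans; cong; subst; subst₂; module ≡-Reasoning)

private
  variable
    n : ℕ

∁-involutive : (p : Subset n) → ∁ (∁ p) ≡ p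
∁-involutive p = begin
  map not (map not p)  ≡⟨ map-∘ not not p ⟨
  map (not ∘ not) p    ≡⟨ map-cong not-involutive p ⟩
  map (λ b → b) p      ≡⟨ map-id p ⟩
  p                    ∎
  where open ≡-Reasoning

x∈p─q⇒x∉q : ∀ {p q : Subset n} {x} → x ∈ p ─ q → x ∉ q
x∈p─q⇒x∉q {p = _ ∷ _} {inside ∷ _} () here
x∈p─q⇒x∉q {p = _ ∷ _} {_ ∷ _} (there x∈p─q) (there x∈q) = x∈p─q⇒x∉q x∈p─q x∈q

x∈p-y⇒x≢y : ∀ {p : Subset n} {x y} → x ∈ p - y → x ≢ y
x∈p-y⇒x≢y = x∉⁅y⁆⇒x≢y ∘ x∈p─q⇒x∉q

x∈∁⁅y⁆⇒x≢y : ∀ {x y : Fin n} → x ∈ ∁ ⁅ y ⁆ → x ≢ y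
x∈∁⁅y⁆⇒x≢y = x∉⁅y⁆⇒x≢y ∘ x∈∁p⇒x∉p

x≢y⇒x∈∁⁅y⁆ : ∀ {x y : Fin n} → x ≢ y → x ∈ ∁ ⁅ y ⁆
x≢y⇒x∈∁⁅y⁆ = x∉p⇒x∈∁p ∘ x≢y⇒x∉⁅y⁆

x∈p⇒∣p∣≡1+∣p-x∣ : ∀ (p : Subset n) {x} → x ∈ p → ∣ p ∣ ≡ suc ∣ p - x ∣
x∈p⇒∣p∣≡1+∣p-x∣ (inside  ∷ p) here      = cong (suc ∘ ∣_∣) (sym (p─⊥≡p p))
x∈p⇒∣p∣≡1+∣p-x∣ (inside  ∷ p) (there x∈p) = cong suc (x∈p⇒∣p∣≡1+∣p-x∣ p x∈p)
x∈p⇒∣p∣≡1+∣p-x∣ (outside ∷ p) (there x∈p) = x∈p⇒∣p∣≡1+∣p-x∣ p x∈p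

∣p∣>0⇒Nonempty : (p : Subset n) → 0 < ∣ p ∣ → Nonempty p
∣p∣>0⇒Nonempty {n} p ∣p∣>0 with nonempty? p
... | yes ne = ne
... | no  ¬ne = contradiction (subst (λ q → 0 < ∣ q ∣) (Empty-unique ¬ne) ∣p∣>0) ∣⊥∣≯0
  where
  ∣⊥∣≯0 : ¬ 0 < ∣ ⊥ {n} ∣
  ∣⊥∣≯0 rewrite ∣⊥∣≡0 n = λ ()

x∈p⇒⁅x⁆⊆p : ∀ {p : Subset n} {x} → x ∈ p → ⁅ x ⁆ ⊆ p
x∈p⇒⁅x⁆⊆p {p = p} {x} x∈p z∈⁅x⁆ = subst (_∈ p) (sym (x∈⁅y⁆⇒x≡y x z∈⁅x⁆)) x∈p

x∈p⇒p≡⁅x⁆⊎Nonempty[p-x] : ∀ {p : Subset n} {x} → x ∈ p → p ≡ ⁅ x ⁆ ⊎ Nonempty (p - x)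
x∈p⇒p≡⁅x⁆⊎Nonempty[p-x] {p = p} {x} x∈p with nonempty? (p - x)
... | yes ne  = inj₂ ne
... | no  ¬ne = inj₁ (⊆-antisym p⊆⁅x⁆ (x∈p⇒⁅x⁆⊆p x∈p))
  where
  p⊆⁅x⁆ : p ⊆ ⁅ x ⁆
  p⊆⁅x⁆ {z} z∈p with z ≟ x
  ... | yes refl = x∈⁅x⁆ x
  ... | no  z≢x  = contradiction (z , x∈p∧x≢y⇒x∈p-y z∈p z≢x) ¬ne

∣p∣≡1⇒p≡⁅x⁆ : (p : Subset n) → ∣ p ∣ ≡ 1 → ∃ λ x → p ≡ ⁅ x ⁆
∣p∣≡1⇒p≡⁅x⁆ p ∣p∣≡1 with ∣p∣>0⇒Nonempty p (subst (0 <_) (sym ∣p∣≡1) (s≤s z≤n))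
... | x , x∈p with x∈p⇒p≡⁅x⁆⊎Nonempty[p-x] x∈p
...   | inj₁ p≡⁅x⁆ = x , p≡⁅x⁆
...   | inj₂ (y , y∈p-x) = contradiction (subst₂ _<_ (∣⁅x⁆∣≡1 x) ∣p∣≡1 ∣⁅x⁆∣<∣p∣) (<-irrefl refl)
  where
  ∣⁅x⁆∣<∣p∣ : ∣ ⁅ x ⁆ ∣ < ∣ p ∣
  ∣⁅x⁆∣<∣p∣ = p⊂q⇒∣p∣<∣q∣
    (x∈p⇒⁅x⁆⊆p x∈p , y , p─q⊆p p _ y∈p-x , x≢y⇒x∉⁅y⁆ (x∈p-y⇒x≢y y∈p-x))

∣p∣≡n⇒p≡∁⁅x⁆ : (p : Subset (suc n)) → ∣ p ∣ ≡ n → ∃ λ x → p ≡ ∁ ⁅ x ⁆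
∣p∣≡n⇒p≡∁⁅x⁆ {n} p ∣p∣≡n =
  let x , ∁p≡⁅x⁆ = ∣p∣≡1⇒p≡⁅x⁆ (∁ p) ∣∁p∣≡1 in x , trans (sym (∁-involutive p)) (cong ∁ ∁p≡⁅x⁆)
  where
  ∣∁p∣≡1 : ∣ ∁ p ∣ ≡ 1
  ∣∁p∣≡1 = trans (∣∁p∣≡n∸∣p∣ p) (trans (cong (suc n ∸_) ∣p∣≡n) (m+n∸n≡m 1 n))

1<∣p∣⇒∃₂∈p : (p : Subset n) → 1 < ∣ p ∣ → ∃₂ λ i j → i ≢ j × i ∈ p × j ∈ p
1<∣p∣⇒∃₂∈p p 1<∣p∣ with ∣p∣>0⇒Nonempty p (≤-trans (s≤s z≤n) 1<∣p∣)
... | i , i∈p with x∈p⇒p≡⁅x⁆⊎Nonempty[p-x] i∈p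
...   | inj₁ p≡⁅i⁆ = contradiction (subst (1 <_) (trans (cong ∣_∣ p≡⁅i⁆) (∣⁅x⁆∣≡1 i)) 1<∣p∣)
                                   (<-irrefl refl)
...   | inj₂ (j , j∈p-i) = i , j , (λ i≡j → x∈p-y⇒x≢y j∈p-i (sym i≡j)) , i∈p , p─q⊆p p _ j∈p-i

p-x⊆q∧x∈q⇒p⊆q : ∀ {p q : Subset n} {x} → p - x ⊆ q → x ∈ q → p ⊆ q
p-x⊆q∧x∈q⇒p⊆q {x = x} p-x⊆q x∈q {z} z∈p with z ≟ x
... | yes refl = x∈q
... | no  z≢x  = p-x⊆q (x∈p∧x≢y⇒x∈p-y z∈p z≢x)

∁⁅x⁆-y⊆q⇒q≡∁⁅y⁆ : ∀ {q : Subset n} {x y} → ∁ ⁅ x ⁆ - y ⊆ q → x ∈ q → y ∉ q → q ≡ ∁ ⁅ y ⁆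
∁⁅x⁆-y⊆q⇒q≡∁⁅y⁆ {x = x} {y} ∁⁅x⁆-y⊆q x∈q y∉q = ⊆-antisym q⊆∁⁅y⁆ ∁⁅y⁆⊆q
  where
  q⊆∁⁅y⁆ : _ ⊆ ∁ ⁅ y ⁆
  q⊆∁⁅y⁆ {z} z∈q = x≢y⇒x∈∁⁅y⁆ λ { refl → y∉q z∈q }
  ∁⁅y⁆⊆q : ∁ ⁅ y ⁆ ⊆ _
  ∁⁅y⁆⊆q {z} z∈∁⁅y⁆ with z ≟ x
  ... | yes refl = x∈q
  ... | no  z≢x  = ∁⁅x⁆-y⊆q (x∈p∧x≢y⇒x∈p-y (x≢y⇒x∈∁⁅y⁆ z≢x) (x∈∁⁅y⁆⇒x≢y z∈∁⁅y⁆))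

∣∁⁅x⁆∣≡n : (x : Fin (suc n)) → ∣ ∁ ⁅ x ⁆ ∣ ≡ n
∣∁⁅x⁆∣≡n {n} x = trans (∣∁p∣≡n∸∣p∣ ⁅ x ⁆) (cong (suc n ∸_) (∣⁅x⁆∣≡1 x))

1+∣∁⁅x⁆-y∣≡n : ∀ {x y : Fin (suc n)} → y ≢ x → suc ∣ ∁ ⁅ x ⁆ - y ∣ ≡ n
1+∣∁⁅x⁆-y∣≡n {x = x} y≢x = trans (sym (x∈p⇒∣p∣≡1+∣p-x∣ (∁ ⁅ x ⁆) (x≢y⇒x∈∁⁅y⁆ y≢x))) (∣∁⁅x⁆∣≡n x)

⋂ᶠ : ∀ {k} → (Fin (suc k) → Subset n) → Subset n
⋂ᶠ {k = zero}  A = A zero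
⋂ᶠ {k = suc k} A = A zero ∩ ⋂ᶠ (A ∘ suc)

x∈⋂ᶠ⁺ : ∀ {k} (A : Fin (suc k) → Subset n) {x} → (∀ w → x ∈ A w) → x ∈ ⋂ᶠ A
x∈⋂ᶠ⁺ {k = zero}  A x∈A = x∈A zero
x∈⋂ᶠ⁺ {k = suc k} A x∈A = x∈p∩q⁺ (x∈A zero , x∈⋂ᶠ⁺ (A ∘ suc) (x∈A ∘ suc))

x∈⋂ᶠ⁻ : ∀ {k} (A : Fin (suc k) → Subset n) {x} → x ∈ ⋂ᶠ A → ∀ w → x ∈ A w
x∈⋂ᶠ⁻ {k = zero}  A x∈⋂A zero    = x∈⋂A
x∈⋂ᶠ⁻ {k = suc k} A x∈⋂A zero    = proj₁ (x∈p∩q⁻ (A zero) _ x∈⋂A)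
x∈⋂ᶠ⁻ {k = suc k} A x∈⋂A (suc w) = x∈⋂ᶠ⁻ (A ∘ suc) (proj₂ (x∈p∩q⁻ (A zero) _ x∈⋂A)) w

⋂ᶠ-closed : ∀ {J : Family n} → IntersectionClosed J →
            ∀ {k} (A : Fin (suc k) → Subset n) → (∀ w → J (A w)) → J (⋂ᶠ A)
⋂ᶠ-closed closed {zero}  A J-A = J-A zero
⋂ᶠ-closed closed {suc k} A J-A = closed _ _ (J-A zero) (⋂ᶠ-closed closed (A ∘ suc) (J-A ∘ suc))

Separates : Family n → Fin n → Fin n → Set
Separates {n} J i z = ∃ λ (A : Subset n) → J A × i ∈ A × z ∉ A

separating⇒singleton : ∀ {J : Family (suc n)} {A i} → IntersectionClosed J → J A → i ∈ A →
                       (∀ z → z ≢ i → Separates J i z) → J ⁅ i ⁆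
separating⇒singleton {n} {J} {A} {i} closed J-A i∈A separates =
  subst J ⋂C≡⁅i⁆ (⋂ᶠ-closed closed C (proj₁ ∘ proj₂ ∘ choose))
  where
  choose : ∀ z → ∃ λ C → J C × i ∈ C × (z ≢ i → z ∉ C)
  choose z with z ≟ i
  ... | yes z≡i = A , J-A , i∈A , contradiction z≡i
  ... | no  z≢i with separates z z≢i
  ...   | C , J-C , i∈C , z∉C = C , J-C , i∈C , λ _ → z∉C
  C : Fin (suc n) → Subset (suc n)
  C = proj₁ ∘ choose
  ⋂C⊆⁅i⁆ : ⋂ᶠ C ⊆ ⁅ i ⁆
  ⋂C⊆⁅i⁆ {z} z∈⋂C with z ≟ i
  ... | yes refl = x∈⁅x⁆ i
  ... | no  z≢i  = contradiction (x∈⋂ᶠ⁻ C z∈⋂C z) (proj₂ (proj₂ (proj₂ (choose z))) z≢i)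
  ⋂C≡⁅i⁆ : ⋂ᶠ C ≡ ⁅ i ⁆
  ⋂C≡⁅i⁆ = ⊆-antisym ⋂C⊆⁅i⁆ (x∈p⇒⁅x⁆⊆p (x∈⋂ᶠ⁺ C (proj₁ ∘ proj₂ ∘ proj₂ ∘ choose)))

HasRank⇒uncovered-∁⁅x⁆ : ∀ {J : Family (suc n)} → HasRank J n →
  ∃ λ x → ¬ Covered J (∁ ⁅ x ⁆) × (∀ y → .(y ≢ x) → Covered J (∁ ⁅ x ⁆ - y))
HasRank⇒uncovered-∁⁅x⁆ {n} ((e , ∣e∣≡n , e-uncovered) , small-covered) with ∣p∣≡n⇒p≡∁⁅x⁆ e ∣e∣≡n
... | x , refl = x , e-uncovered , λ y y≢x → small-covered (∁ ⁅ x ⁆ - y)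
  (recompute (∣ ∁ ⁅ x ⁆ - y ∣ <? n) (subst (∣ ∁ ⁅ x ⁆ - y ∣ <_) (1+∣∁⁅x⁆-y∣≡n y≢x) ≤-refl))

module UncoveredHyperplane
  {k} (J : Family (suc k)) (closed : IntersectionClosed J) (x : Fin (suc k))
  (uncovered : ¬ Covered J (∁ ⁅ x ⁆))
  (cover : ∀ y → .(y ≢ x) → Covered J (∁ ⁅ x ⁆ - y))
  where

  B : ∀ y → .(y ≢ x) → Subset (suc k)
  B y y≢x = proj₁ (cover y y≢x)

  J-B : ∀ y .(y≢x : y ≢ x) → J (B y y≢x)
  J-B y y≢x = proj₁ (proj₂ (cover y y≢x))

  ∁⁅x⁆-y⊆B : ∀ y .(y≢x : y ≢ x) → ∁ ⁅ x ⁆ - y ⊆ B y y≢x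
  ∁⁅x⁆-y⊆B y y≢x = proj₂ (proj₂ (cover y y≢x))

  y∉B : ∀ y .(y≢x : y ≢ x) → y ∉ B y y≢x
  y∉B y y≢x y∈B = uncovered (B y y≢x , J-B y y≢x , p-x⊆q∧x∈q⇒p⊆q (∁⁅x⁆-y⊆B y y≢x) y∈B)

  ThroughX : Fin (suc k) → Set
  ThroughX y = ∀ (y≢x : y ≢ x) → x ∈ B y y≢x

  allThroughX⇒Central : (∀ y → ThroughX y) → Central J
  allThroughX⇒Central x∈B = x , J-hyperplane , λ J-∁⁅x⁆ → uncovered (∁ ⁅ x ⁆ , J-∁⁅x⁆ , λ z∈ → z∈)
    where
    J-hyperplane : ∀ S → ∣ S ∣ ≡ k → x ∈ S → J S
    J-hyperplane S ∣S∣≡k x∈S with ∣p∣≡n⇒p≡∁⁅x⁆ S ∣S∣≡k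
    ... | y , refl = subst J (∁⁅x⁆-y⊆q⇒q≡∁⁅y⁆ (∁⁅x⁆-y⊆B y y≢x) (x∈B y y≢x) (y∉B y y≢x)) (J-B y y≢x)
      where
      y≢x : y ≢ x
      y≢x = x∈∁⁅y⁆⇒x≢y x∈S ∘ sym

  -- B y y≢x does not depend on the (irrelevant) proof y≢x, so one proof decides all of them.
  throughX? : ∀ y → Dec (ThroughX y)
  throughX? y with y ≟ x
  ... | yes y≡x = yes (λ y≢x → contradiction y≡x y≢x)
  ... | no  y≢x with x ∈? B y y≢x
  ...   | yes x∈B = yes (λ _ → x∈B)
  ...   | no  x∉B = no (λ x∈B → x∉B (x∈B y≢x))

  ¬Central⇒singletons : ¬ Central J → ∃ λ y → y ≢ x × (∀ i → i ∈ ∁ ⁅ x ⁆ - y → J ⁅ i ⁆)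
  ¬Central⇒singletons ¬central with ¬∀⟶∃¬ (suc k) ThroughX throughX? (¬central ∘ allThroughX⇒Central)
  ... | y₀ , ¬x∈B₀ = y₀ , y₀≢x , J-⁅i⁆
    where
    y₀≢x : y₀ ≢ x
    y₀≢x y₀≡x = ¬x∈B₀ (λ y₀≢x → contradiction y₀≡x y₀≢x)
    x∉B₀ : x ∉ B y₀ y₀≢x
    x∉B₀ x∈B₀ = ¬x∈B₀ (λ _ → x∈B₀)
    J-⁅i⁆ : ∀ i → i ∈ ∁ ⁅ x ⁆ - y₀ → J ⁅ i ⁆
    J-⁅i⁆ i i∈ = separating⇒singleton closed (J-B y₀ y₀≢x) (∁⁅x⁆-y⊆B y₀ y₀≢x i∈) separates
      where
      separates : ∀ z → z ≢ i → Separates J i z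
      separates z z≢i with z ≟ x
      ... | yes refl = B y₀ y₀≢x , J-B y₀ y₀≢x , ∁⁅x⁆-y⊆B y₀ y₀≢x i∈ , x∉B₀
      ... | no  z≢x  = B z z≢x , J-B z z≢x
                     , ∁⁅x⁆-y⊆B z z≢x (x∈p∧x≢y⇒x∈p-y (p─q⊆p _ _ i∈) (z≢i ∘ sym)) , y∉B z z≢x

lemma4p9 : (r : ℕ) → 4 ≤ r → (J : Family r) → ProperFamily J → IntersectionClosed J
    → HasRank J (r ∸ 1) → ¬ Central J
    → Σ (Fin r) λ i → Σ (Fin r) λ j → (i ≢ j) × J ⁅ i ⁆ × J ⁅ j ⁆
lemma4p9 _ (s≤s (s≤s (s≤s (s≤s _)))) J _ closed rank ¬central =
  let x , uncovered , cover = HasRank⇒uncovered-∁⁅x⁆ rank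
      y , y≢x , J-⁅_⁆ = UncoveredHyperplane.¬Central⇒singletons J closed x uncovered cover ¬central
      1<∣∁⁅x⁆-y∣ = subst (1 <_) (sym (suc-injective (1+∣∁⁅x⁆-y∣≡n y≢x))) (s≤s (s≤s z≤n))
      i , j , i≢j , i∈ , j∈ = 1<∣p∣⇒∃₂∈p (∁ ⁅ x ⁆ - y) 1<∣∁⁅x⁆-y∣
  in i , j , i≢j , J-⁅ i ⁆ i∈ , J-⁅ j ⁆ j∈
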